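{- Let $\mathbb{A}$ be either the equality atoms or the ordered atoms, and take the set of basic predicates equal to $\mathbb{A}$. There exists a formula $\phi$ of the scalar atomic $\mu$-calculus $\mathcal{L}_\mu^{\mathbb{A}}$ without free variables which is satisfiable (there is an atomic Kripke model $\mathcal{K}$ and a state $x$ of $\mathcal{K}$ with $x\models\phi$) but has no orbit-finite model (there is no orbit-finite atomic Kripke model with a state satisfying $\phi$).
   Context: Atoms: either (equality atoms) $\mathbb{A}$ is a countably infinite set and $\mathrm{Aut}(\mathbb{A})$ is the group of all its bijections, or (ordered atoms) $\mathbb{A}=\mathbb{Q}$ and $\mathrm{Aut}(\mathbb{A})$ is the group of order-preserving bijections. Sets with atoms are built hereditarily from atoms; $\mathrm{Aut}(\mathbb{A})$ acts on them by renaming atoms; a finite $S\subseteq\mathbb{A}$ supports $x$ if every automorphism fixing $S$ pointwise fixes $x$; only hereditarily finitely supported sets are considered; a set is orbit-finite if it is a finite union of $S$-orbits $\{x\cdot\pi:\pi$ fixes $S$ pointwise$\}$ for some finite support $S$. An atomic Kripke model over $\mathbb{P}=\mathbb{A}$ is $(K,\longrightarrow,\models)$ with $K$ a set with atoms and finitely supported $\longrightarrow\subseteq K\times K$, $\models\subseteq K\times\mathbb{A}$; it is orbit-finite if $K$ is. $\mathcal{L}_\mu^{\mathbb{A}}$ formulas (variables from an equivariant set $\mathbb{X}$): $\phi::=p\mid X\mid\bigvee\Phi\mid\neg\phi\mid\diamondsuit\phi\mid\mu X.\phi$ with $\Phi$ an orbit-finite set of formulas and $X$ occurring positively in $\phi$.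 Semantics: $[\![p]\!]=\{x:x\models p\}$, $[\![X]\!]_\rho=\rho(X)$, complement, union over $\Phi$, $[\![\diamondsuit\phi]\!]_\rho=\{x:\exists y\in[\![\phi]\!]_\rho.\ x\longrightarrow y\}$, $[\![\mu X.\phi]\!]_\rho$ the least fixpoint of $A\mapsto[\![\phi]\!]_{\rho[X\mapsto A]}$; $x\models\phi$ iff $x\in[\![\phi]\!]$ for the empty environment. -}

module Defs where

open import Level using (Lift; lift) renaming (suc to lsuc; zero to lzero)
open import Data.Nat as ℕ using (ℕ)
open import Data.Rational as Q using (ℚ)
open import Data.Product using (Σ; _×_; _,_; proj₁; proj₂)
open import Data.List using (List; []; _∷_; map)
open import Data.List.Membership.Propositional using (_∈_)
open import Data.List.Relation.Unary.Any using (Any)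
open import Data.Empty using (⊥)
open import Data.Unit using (⊤; tt)
open import Relation.Nullary using (¬_; yes; no)
open import Relation.Binary.Definitions using (DecidableEquality)
open import Relation.Binary.PropositionalEquality using (_≡_; refl; trans; cong)
import Data.Product.Properties as ×P
import Data.List.Properties as LP

-- Atoms: equality atoms (a countably infinite set, here ℕ, with all
-- bijections) or ordered atoms (ℚ with order-preserving bijections).

data AtomKind : Set where
  equality ordered : AtomKind

Atom : AtomKind → Set
Atom equality = ℕ
Atom ordered  = ℚ

_≟A_ : {k : AtomKind} → DecidableEquality (Atom k)
_≟A_ {equality} = ℕ._≟_
_≟A_ {ordered}  = Q._≟_

Mono : (k : AtomKind) → (Atom k → Atom k) → Set
Mono equality f = ⊤
Mono ordered  f = ∀ a b → a Q.< b → f a Q.< f b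

record Aut (k : AtomKind) : Set where
  field
    to    : Atom k → Atom k
    from  : Atom k → Atom k
    from∘to : ∀ a → from (to a) ≡ a
    to∘from : ∀ a → to (from a) ≡ a
    mono  : Mono k to
open Aut public

idA : {k : AtomKind} → Aut k
idA {equality} = record { to = λ a → a ; from = λ a → a ; from∘to = λ _ → refl ; to∘from = λ _ → refl ; mono = tt }
idA {ordered}  = record { to = λ a → a ; from = λ a → a ; from∘to = λ _ → refl ; to∘from = λ _ → refl ; mono = λ _ _ p → p }

mono-∘ : (k : AtomKind) (f g : Atom k → Atom k) → Mono k f → Mono k g → Mono k (λ a → g (f a))
mono-∘ equality f g _ _ = tt
mono-∘ ordered  f g mf mg = λ a b p → mg (f a) (f b) (mf a b p)

_∘A_ : {k : AtomKind} → Aut k → Aut k → Aut k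
_∘A_ {k} σ π = record
  { to = λ a → to σ (to π a)
  ; from = λ a → from π (from σ a)
  ; from∘to = λ a → trans (cong (from π) (from∘to σ (to π a))) (from∘to π a)
  ; to∘from = λ a → trans (cong (to σ) (to∘from π (from σ a))) (to∘from σ a)
  ; mono = mono-∘ k (to π) (to σ) (mono π) (mono σ)
  }

Fixes : {k : AtomKind} → Aut k → List (Atom k) → Set
Fixes π T = ∀ a → a ∈ T → to π a ≡ a

fixes-id : {k : AtomKind} (T : List (Atom k)) → Fixes (idA {k}) T
fixes-id {equality} T _ _ = refl
fixes-id {ordered}  T _ _ = refl

fixes-∘ : {k : AtomKind} {σ π : Aut k} (T : List (Atom k)) →
          Fixes σ T → Fixes π T → Fixes (σ ∘A π) T
fixes-∘ {σ = σ} T fσ fπ a a∈T = trans (cong (to σ) (fπ a a∈T)) (fσ a a∈T)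

-- K is a set with atoms supported by a finite set S (so Aut_S, the
-- automorphisms fixing S pointwise, act on K); every element of K is
-- finitely supported; ⟶ and ⊨ are supported by S.  Equality of states
-- is an arbitrary equivalence (setoid) respected by everything.

record Model (k : AtomKind) : Set₁ where
  field
    S       : List (Atom k)
    State   : Set
    _≈_     : State → State → Set
    ≈-refl  : ∀ {x} → x ≈ x
    ≈-sym   : ∀ {x y} → x ≈ y → y ≈ x
    ≈-trans : ∀ {x y z} → x ≈ y → y ≈ z → x ≈ z
    act     : (π : Aut k) → Fixes π S → State → State
    act-cong : ∀ π p {x y} → x ≈ y → act π p x ≈ act π p y
    act-ext  : ∀ π p σ q → (∀ a → to π a ≡ to σ a) → ∀ x → act π p x ≈ act σ q x
    act-id   : ∀ x → act idA (fixes-id S) x ≈ x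
    act-∘    : ∀ σ q π p x → act (σ ∘A π) (fixes-∘ {σ = σ} {π = π} S q p) x ≈ act σ q (act π p x)
    fin-supp : ∀ x → Σ (List (Atom k)) λ T → ∀ π p → Fixes π T → act π p x ≈ x
    _⟶_     : State → State → Set
    ⟶-resp  : ∀ {x x' y y'} → x ≈ x' → y ≈ y' → x ⟶ y → x' ⟶ y'
    ⟶-supp  : ∀ π p x y → (x ⟶ y → act π p x ⟶ act π p y) × (act π p x ⟶ act π p y → x ⟶ y)
    _⊨_     : State → Atom k → Set
    ⊨-resp  : ∀ {x x' a} → x ≈ x' → x ⊨ a → x' ⊨ a
    ⊨-supp  : ∀ π p x a → (x ⊨ a → act π p x ⊨ to π a) × (act π p x ⊨ to π a → x ⊨ a)

-- orbit-finite: for some finite T (so that S ∪ T is a finite support of K),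
-- K is a finite union of (S ∪ T)-orbits.
OrbitFiniteModel : {k : AtomKind} → Model k → Set
OrbitFiniteModel {k} M = Σ (List (Atom k)) λ T → Σ (List State) λ reps →
    ∀ y → Any (λ r → Σ (Aut k) λ π → Σ (Fixes π S) λ (p : Fixes π S) → Fixes π T × (y ≈ act π p r)) reps
  where open Model M

-- Formulas of L_μ^𝔸.  Variables come from the equivariant set
-- 𝕏 = ℕ × List 𝔸.  An (orbit-finite) set of formulas Φ is presented as
-- a family f : I → Form k (Φ = image of f).

Var : AtomKind → Set
Var k = ℕ × List (Atom k)

_≟V_ : {k : AtomKind} → DecidableEquality (Var k)
_≟V_ = ×P.≡-dec ℕ._≟_ (LP.≡-dec _≟A_)

actV : {k : AtomKind} → Aut k → Var k → Var k
actV π (n , as) = n , map (to π) as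

data Form (k : AtomKind) : Set₁ where
  atom : Atom k → Form k
  var  : Var k → Form k
  disj : (I : Set) → (I → Form k) → Form k
  neg  : Form k → Form k
  dia  : Form k → Form k
  mu   : Var k → Form k → Form k

actF : {k : AtomKind} → Aut k → Form k → Form k
actF π (atom a)   = atom (to π a)
actF π (var X)    = var (actV π X)
actF π (disj I f) = disj I (λ i → actF π (f i))
actF π (neg φ)    = neg (actF π φ)
actF π (dia φ)    = dia (actF π φ)
actF π (mu X φ)   = mu (actV π X) (actF π φ)

-- equality of formulas (syntactic; disjunctions compared as sets)
_≈F_ : {k : AtomKind} → Form k → Form k → Set
atom a   ≈F atom b   = a ≡ b
var X    ≈F var Y    = X ≡ Y
disj I f ≈F disj J g = (∀ i → Σ J λ j → f i ≈F g j) × (∀ j → Σ I λ i → f i ≈F g j)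
neg φ    ≈F neg ψ    = φ ≈F ψ
dia φ    ≈F dia ψ    = φ ≈F ψ
mu X φ   ≈F mu Y ψ   = (X ≡ Y) × (φ ≈F ψ)
_        ≈F _        = ⊥

OrbitFiniteFam : {k : AtomKind} (I : Set) → (I → Form k) → Set
OrbitFiniteFam {k} I f = Σ (List (Atom k)) λ T →
    (∀ π → Fixes π T →
       (∀ i → Σ I λ j → actF π (f i) ≈F f j) × (∀ j → Σ I λ i → actF π (f i) ≈F f j))
  × Σ (List I) λ reps →
    ∀ i → Any (λ r → Σ (Aut k) λ π → Fixes π T × (f i ≈F actF π (f r))) reps

mutual
  Pos : {k : AtomKind} → Var k → Form k → Set
  Pos X (atom a)   = ⊤
  Pos X (var Y)    = ⊤
  Pos X (disj I f) = ∀ i → Pos X (f i)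
  Pos X (neg φ)    = Neg X φ
  Pos X (dia φ)    = Pos X φ
  Pos X (mu Y φ) with X ≟V Y
  ... | yes _ = ⊤
  ... | no  _ = Pos X φ

  Neg : {k : AtomKind} → Var k → Form k → Set
  Neg X (atom a)   = ⊤
  Neg X (var Y)    = ¬ (X ≡ Y)
  Neg X (disj I f) = ∀ i → Neg X (f i)
  Neg X (neg φ)    = Pos X φ
  Neg X (dia φ)    = Neg X φ
  Neg X (mu Y φ) with X ≟V Y
  ... | yes _ = ⊤
  ... | no  _ = Neg X φ

WF : {k : AtomKind} → Form k → Set₁
WF (atom a)   = Lift (lsuc lzero) ⊤
WF (var X)    = Lift (lsuc lzero) ⊤
WF (disj I f) = (∀ i → WF (f i)) × OrbitFiniteFam I f
WF (neg φ)    = WF φ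
WF (dia φ)    = WF φ
WF (mu X φ)   = WF φ × Lift (lsuc lzero) (Pos X φ)

Free : {k : AtomKind} → Var k → Form k → Set
Free X (atom a)   = ⊥
Free X (var Y)    = X ≡ Y
Free X (disj I f) = Σ I λ i → Free X (f i)
Free X (neg φ)    = Free X φ
Free X (dia φ)    = Free X φ
Free X (mu Y φ)   = ¬ (X ≡ Y) × Free X φ

Closed : {k : AtomKind} → Form k → Set
Closed {k} φ = ∀ (X : Var k) → ¬ Free X φ

module _ {k : AtomKind} (M : Model k) where
  open Model M

  Env : Set₂
  Env = Var k → State → Set₁

  _[_↦_] : Env → Var k → (State → Set₁) → Env
  (ρ [ X ↦ A ]) Y with X ≟V Y
  ... | yes _ = A
  ... | no  _ = ρ Y

  -- ⟦ μX.φ ⟧ is the least fixpoint: the intersection of all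
  -- prefixed points A (⟦φ⟧_{ρ[X↦A]} ⊆ A).
  ⟦_⟧ : Form k → Env → State → Set₁
  ⟦ atom a ⟧   ρ x = Lift (lsuc lzero) (x ⊨ a)
  ⟦ var X ⟧    ρ x = ρ X x
  ⟦ disj I f ⟧ ρ x = Σ (Lift (lsuc lzero) I) λ i → ⟦ f (Level.lower i) ⟧ ρ x
  ⟦ neg φ ⟧    ρ x = ¬ ⟦ φ ⟧ ρ x
  ⟦ dia φ ⟧    ρ x = Σ (Lift (lsuc lzero) State) λ y → Lift (lsuc lzero) (x ⟶ Level.lower y) × ⟦ φ ⟧ ρ (Level.lower y)
  ⟦ mu X φ ⟧   ρ x = ∀ (A : State → Set) →
                       (∀ y → ⟦ φ ⟧ (ρ [ X ↦ (λ z → Lift (lsuc lzero) (A z)) ]) y → A y) → A x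

  emptyEnv : Env
  emptyEnv _ _ = Lift (lsuc lzero) ⊥

  Sat : State → Form k → Set₁
  Sat x φ = ⟦ φ ⟧ emptyEnv x

-- Φ = noAtom ∧ νX₀. persistent ∧ ⋁ₐ (¬a ∧ onlyGains a ∧ ◇(a ∧ X₀)) says that no
-- predicate holds now and that there is an infinite path along which every
-- step keeps the old predicates and gains exactly one new one.
--
-- It is also closed.
--  * Satisfiability: the empty history satisfies Φ in the model of fresh
--    histories, whose transitions collect one new atom at a time.
--  * No orbit-finite model: from a state without predicates, the n-th state
--    of a chain of such steps has exactly n predicates; two states in one
--    orbit have injectively renamable predicates, so by pigeonhole no chain
--    outlasts the number of orbits, while a model of Φ has chains of every
--    length.  Since negation is constructive, this runs in the ¬¬-monad.

module Submission where

open import Defs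
open import Level using (Lift; lift)
open import Data.Bool using (Bool; true; false; if_then_else_)
open import Data.Empty using (⊥; ⊥-elim)
open import Data.Fin using (Fin; toℕ; fromℕ<)
import Data.Fin.Properties as FinP
open import Data.List using (List; []; _∷_; map; length; lookup)
import Data.List.Extrema
open import Data.List.Membership.Propositional using (_∈_; _∉_)
open import Data.List.Membership.Propositional.Properties using (∈-map⁺; ∈-map⁻)
import Data.List.Properties as ListP
import Data.List.Relation.Unary.All as All
open import Data.List.Relation.Unary.Any using (Any; here; there)
import Data.List.Relation.Unary.Any as Any
open import Data.List.Relation.Unary.Any.Properties using (lookup-index)
open import Data.Nat as ℕ using (ℕ; zero; suc; s≤s; s≤s⁻¹; _<_; _≤_)
import Data.Nat.Properties as ℕP
open import Data.Product using (Σ; _×_; _,_; proj₁; proj₂)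
open import Data.Rational as ℚ using (ℚ; 0ℚ; 1ℚ)
import Data.Rational.Properties as ℚP
open import Data.Rational.Solver using (module +-*-Solver)
open import Data.Sum using (_⊎_; inj₁; inj₂; [_,_])
open import Data.Unit using (tt)
open import Function using (_∘_)
open import Function.Definitions using (Injective)
open import Relation.Binary.Bundles using (DecTotalOrder)
open import Relation.Binary.Definitions using (tri<; tri≈; tri>)
open import Relation.Binary.PropositionalEquality hiding ([_])
open import Relation.Nullary using (¬_; yes; no)
open import Relation.Nullary.Negation using (contradiction)

to-injective : ∀ {k} (π : Aut k) → Injective _≡_ _≡_ (to π)
to-injective π {a} {b} e = trans (sym (from∘to π a)) (trans (cong (from π) e) (from∘to π b))

to-idA : ∀ {k} (a : Atom k) → to (idA {k}) a ≡ a
to-idA {equality} a = refl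
to-idA {ordered}  a = refl

fixes-singleton : ∀ {k} (π : Aut k) {a} → to π a ≡ a → Fixes π (a ∷ [])
fixes-singleton π e _ (here refl) = e

module Transposition where

  swap : ℕ → ℕ → ℕ → ℕ
  swap u v x with x ℕ.≟ u | x ℕ.≟ v
  ... | yes _ | _     = v
  ... | no _  | yes _ = u
  ... | no _  | no _  = x

  swap-left : ∀ u v → swap u v u ≡ v
  swap-left u v with u ℕ.≟ u
  ... | yes _ = refl
  ... | no u≢u = contradiction refl u≢u

  swap-right : ∀ u v → swap u v v ≡ u
  swap-right u v with v ℕ.≟ u | v ℕ.≟ v
  ... | yes v≡u | _      = v≡u
  ... | no _    | yes _  = refl
  ... | no _    | no v≢v = contradiction refl v≢v

  swap-other : ∀ u v x → x ≢ u → x ≢ v → swap u v x ≡ x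
  swap-other u v x x≢u x≢v with x ℕ.≟ u | x ℕ.≟ v
  ... | yes x≡u | _       = contradiction x≡u x≢u
  ... | no _    | yes x≡v = contradiction x≡v x≢v
  ... | no _    | no _    = refl

  swap-involutive : ∀ u v x → swap u v (swap u v x) ≡ x
  swap-involutive u v x with x ℕ.≟ u | x ℕ.≟ v
  ... | yes refl | _        = swap-right u v
  ... | no _     | yes refl = swap-left u v
  ... | no x≢u   | no x≢v   = swap-other u v x x≢u x≢v

  transposition : ℕ → ℕ → Aut equality
  transposition u v = record
    { to = swap u v ; from = swap u v
    ; from∘to = swap-involutive u v ; to∘from = swap-involutive u v ; mono = tt }

module Affine where
  open +-*-Solver

  private
    cancel : ∀ u v x d e → d ℚ.* e ≡ 1ℚ → u ℚ.+ d ℚ.* ((v ℚ.+ e ℚ.* (x ℚ.- u)) ℚ.- v) ≡ x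
    cancel u v x d e de≡1 = begin
      u ℚ.+ d ℚ.* ((v ℚ.+ e ℚ.* (x ℚ.- u)) ℚ.- v)
        ≡⟨ solve 5 (λ u v x d e → u :+ d :* ((v :+ e :* (x :- u)) :- v)
                               := u :+ (d :* e) :* (x :- u)) refl u v x d e ⟩
      u ℚ.+ (d ℚ.* e) ℚ.* (x ℚ.- u)
        ≡⟨ cong (λ w → u ℚ.+ w ℚ.* (x ℚ.- u)) de≡1 ⟩
      u ℚ.+ 1ℚ ℚ.* (x ℚ.- u)
        ≡⟨ solve 2 (λ u x → u :+ con 1ℚ :* (x :- u) := x) refl u x ⟩
      x ∎
      where open ≡-Reasoning

  affine : (c : ℚ) .{{_ : ℚ.Positive c}} → ℚ → ℚ → Aut ordered
  affine c u v = record
    { to      = λ x → u ℚ.+ c ℚ.* (x ℚ.- v)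
    ; from    = λ x → v ℚ.+ c⁻¹ ℚ.* (x ℚ.- u)
    ; from∘to = λ x → cancel v u x c⁻¹ c (trans (ℚP.*-comm c⁻¹ c) c·c⁻¹≡1)
    ; to∘from = λ x → cancel u v x c c⁻¹ c·c⁻¹≡1
    ; mono    = λ a b a<b → ℚP.+-monoʳ-< u (ℚP.*-monoʳ-<-pos c (ℚP.+-monoˡ-< (ℚ.- v) a<b))
    }
    where
    instance
      c≢0 : ℚ.NonZero c
      c≢0 = ℚP.pos⇒nonZero c
    c⁻¹ : ℚ
    c⁻¹ = ℚ.1/ c
    c·c⁻¹≡1 : c ℚ.* c⁻¹ ≡ 1ℚ
    c·c⁻¹≡1 = ℚP.*-inverseʳ c

open Transposition using (transposition; swap-left; swap-other)
open Affine using (affine)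

private
  q<q+1 : ∀ q → q ℚ.< q ℚ.+ 1ℚ
  q<q+1 q = subst (ℚ._< q ℚ.+ 1ℚ) (ℚP.+-identityʳ q) (ℚP.+-monoʳ-< q (ℚP.positive⁻¹ 1ℚ))

  positive-difference : ∀ {a b} → a ℚ.< b → ℚ.Positive (b ℚ.- a)
  positive-difference {a} {b} a<b =
    ℚ.positive (subst (ℚ._< b ℚ.- a) (ℚP.+-inverseʳ a) (ℚP.+-monoˡ-< (ℚ.- a) a<b))

homogeneous : ∀ {k} → Σ (Atom k) λ a₀ → ∀ a → Σ (Aut k) λ π → to π a₀ ≡ a
homogeneous {equality} = 0 , λ a → transposition 0 a , swap-left 0 a
homogeneous {ordered}  = 0ℚ , λ a → affine 1ℚ a 0ℚ ,
  solve 1 (λ a → a :+ con 1ℚ :* (con 0ℚ :- con 0ℚ) := a) refl a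
  where open +-*-Solver

OtherAtom : ∀ {k} → Atom k → Set
OtherAtom {k} a = Σ (Atom k) λ b → b ≢ a

-- The automorphisms fixing a have finitely many orbits on the atoms
-- different from a: one for equality atoms, two (above and below a) for
-- ordered atoms.
otherAtomOrbits : ∀ {k} (a : Atom k) → Σ (List (OtherAtom a)) λ reps →
  ∀ b → b ≢ a → Any (λ r → Σ (Aut k) λ π → Fixes π (a ∷ []) × to π (proj₁ r) ≡ b) reps
otherAtomOrbits {equality} a = ((suc a , a≢1+a ∘ sym) ∷ []) , λ b b≢a →
    here (transposition (suc a) b
         , fixes-singleton (transposition (suc a) b) (swap-other (suc a) b a a≢1+a (b≢a ∘ sym))
         , swap-left (suc a) b)
  where
  a≢1+a : a ≢ suc a
  a≢1+a e = ℕP.<-irrefl e (ℕP.n<1+n a)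
otherAtomOrbits {ordered} a = ((a ℚ.+ 1ℚ , a+1≢a) ∷ (a ℚ.- 1ℚ , a-1≢a) ∷ []) , cover
  where
  open +-*-Solver
  a+1≢a : a ℚ.+ 1ℚ ≢ a
  a+1≢a e = ℚP.<⇒≢ (q<q+1 a) (sym e)
  a-1≢a : a ℚ.- 1ℚ ≢ a
  a-1≢a = ℚP.<⇒≢ (subst (a ℚ.- 1ℚ ℚ.<_) (solve 1 (λ a → (a :- con 1ℚ) :+ con 1ℚ := a) refl a)
                                       (q<q+1 (a ℚ.- 1ℚ)))
  dilation-fixes : ∀ c .{{_ : ℚ.Positive c}} → Fixes (affine c a a) (a ∷ [])
  dilation-fixes c = fixes-singleton (affine c a a) (solve 2 (λ a c → a :+ c :* (a :- a) := a) refl a c)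
  cover : ∀ b → b ≢ a → Any (λ r → Σ (Aut ordered) λ π → Fixes π (a ∷ []) × to π (proj₁ r) ≡ b) _
  cover b b≢a with ℚP.<-cmp a b
  ... | tri< a<b _ _ = here (affine (b ℚ.- a) a a , dilation-fixes (b ℚ.- a) ,
          solve 2 (λ a b → a :+ (b :- a) :* ((a :+ con 1ℚ) :- a) := b) refl a b)
    where instance _ = positive-difference a<b
  ... | tri≈ _ a≡b _ = contradiction (sym a≡b) b≢a
  ... | tri> _ _ b<a = there (here (affine (a ℚ.- b) a a , dilation-fixes (a ℚ.- b) ,
          solve 2 (λ a b → a :+ (a :- b) :* ((a :- con 1ℚ) :- a) := b) refl a b))
    where instance _ = positive-difference b<a

fresh : ∀ {k} (L : List (Atom k)) → Σ (Atom k) λ c → c ∉ L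
fresh {equality} L = suc m , λ c∈L → ℕP.<-irrefl refl (s≤s (All.lookup (xs≤max 0 L) c∈L))
  where
  open Data.List.Extrema ℕP.≤-totalOrder using (max; xs≤max)
  m : ℕ
  m = max 0 L
fresh {ordered} L = m ℚ.+ 1ℚ , λ c∈L → ℚP.<-irrefl refl (ℚP.≤-<-trans (All.lookup (xs≤max 0ℚ L) c∈L) (q<q+1 m))
  where
  open Data.List.Extrema (DecTotalOrder.totalOrder ℚP.≤-decTotalOrder) using (max; xs≤max)
  m : ℚ
  m = max 0ℚ L

module _ {k : AtomKind} where

  _∨_ : Form k → Form k → Form k
  φ ∨ ψ = disj Bool (λ b → if b then φ else ψ)

  _∧_ : Form k → Form k → Form k
  φ ∧ ψ = neg (neg φ ∨ neg ψ)

  infixr 6 _∧_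
  infixr 5 _∨_

  ⋁ : (Atom k → Form k) → Form k
  ⋁ F = disj (Atom k) F

  ⋁≠ : Atom k → (Atom k → Form k) → Form k
  ⋁≠ a F = disj (OtherAtom a) (λ r → F (proj₁ r))

  -- Equality of formulas in both directions (≈F is symmetric only
  -- propositionally; carrying both directions avoids proving that).
  _≃_ : Form k → Form k → Set
  φ ≃ ψ = (φ ≈F ψ) × (ψ ≈F φ)

  disj-≃ : ∀ {I J} {f : I → Form k} {g : J → Form k} →
           (∀ i → Σ J λ j → f i ≃ g j) → (∀ j → Σ I λ i → f i ≃ g j) → disj I f ≃ disj J g
  disj-≃ fw bw = ((λ i → proj₁ (fw i) , proj₁ (proj₂ (fw i))) , (λ j → proj₁ (bw j) , proj₁ (proj₂ (bw j))))
               , ((λ j → proj₁ (bw j) , proj₂ (proj₂ (bw j))) , (λ i → proj₁ (fw i) , proj₂ (proj₂ (fw i))))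

  ∨-≃ : ∀ π {φ ψ φ' ψ'} → actF π φ ≃ φ' → actF π ψ ≃ ψ' → actF π (φ ∨ ψ) ≃ (φ' ∨ ψ')
  ∨-≃ π {φ} {ψ} {φ'} {ψ'} eφ eψ =
    disj-≃ {f = λ b → actF π (if b then φ else ψ)} {g = λ b → if b then φ' else ψ'}
           (λ b → b , componentwise b) (λ b → b , componentwise b)
    where
    componentwise : ∀ b → actF π (if b then φ else ψ) ≃ (if b then φ' else ψ')
    componentwise true  = eφ
    componentwise false = eψ

  ∧-≃ : ∀ π {φ ψ φ' ψ'} → actF π φ ≃ φ' → actF π ψ ≃ ψ' → actF π (φ ∧ ψ) ≃ (φ' ∧ ψ')
  ∧-≃ π = ∨-≃ π

  Supp : List (Atom k) → Form k → Set
  Supp T φ = ∀ π → Fixes π T → actF π φ ≃ φ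

  Equivariant : (Atom k → Form k) → Set
  Equivariant F = ∀ π b → actF π (F b) ≃ F (to π b)

  supp-at : ∀ {F} → Equivariant F → ∀ b → Supp (b ∷ []) (F b)
  supp-at {F} eqv b π fix = subst (λ c → actF π (F b) ≃ F c) (fix b (here refl)) (eqv π b)

  rename-at : ∀ {F} → Equivariant F → ∀ π {b c} → to π b ≡ c → actF π (F b) ≃ F c
  rename-at {F} eqv π {b} e = subst (λ c → actF π (F b) ≃ F c) e (eqv π b)

  atom-equivariant : Equivariant atom
  atom-equivariant π b = refl , refl

  ⋁-invariant : ∀ {F} → Equivariant F → Supp [] (⋁ F)
  ⋁-invariant {F} eqv π _ = disj-≃ {f = λ b → actF π (F b)} {g = F} (λ b → to π b , eqv π b)
                                   (λ c → from π c , rename-at {F} eqv π (to∘from π c))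

  ⋁≠-equivariant : ∀ {F} → Equivariant F → Equivariant (λ a → ⋁≠ a F)
  ⋁≠-equivariant {F} eqv π a = disj-≃ {f = λ r → actF π (F (proj₁ r))} {g = λ r → F (proj₁ r)}
    (λ { (b , b≢a) → (to π b , λ e → b≢a (to-injective π e)) , eqv π b })
    (λ { (c , c≢πa) → (from π c , λ e → c≢πa (trans (sym (to∘from π c)) (cong (to π) e)))
                     , rename-at {F} eqv π (to∘from π c) })

  orbitFinite : ∀ {I} (f : I → Form k) T → Supp T (disj I f) → (reps : List I) →
    (∀ i → Any (λ r → Σ (Aut k) λ π → Fixes π T × actF π (f r) ≃ f i) reps) →
    OrbitFiniteFam I f
  orbitFinite f T supp reps cover = T , (λ π fix → proj₁ (supp π fix)) , reps ,
    λ i → Any.map (λ { (π , fix , e) → π , fix , proj₂ e }) (cover i)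

  wf-∨ : ∀ T {φ ψ} → Supp T φ → Supp T ψ → WF φ → WF ψ → WF (φ ∨ ψ)
  wf-∨ T {φ} {ψ} sφ sψ wφ wψ = (λ { true → wφ ; false → wψ }) ,
    orbitFinite (λ b → if b then φ else ψ) T (λ π fix → ∨-≃ π (sφ π fix) (sψ π fix)) (true ∷ false ∷ [])
      (λ { true  → here (idA , fixes-id T , sφ idA (fixes-id T))
         ; false → there (here (idA , fixes-id T , sψ idA (fixes-id T))) })

  wf-∧ : ∀ T {φ ψ} → Supp T φ → Supp T ψ → WF φ → WF ψ → WF (φ ∧ ψ)
  wf-∧ T {φ} {ψ} = wf-∨ T {neg φ} {neg ψ}

  -- A disjunction over all atoms of an equivariant family is orbit-finite:
  -- by homogeneity, a single representative suffices.
  wf-⋁ : ∀ {F} → Equivariant F → (∀ a → WF (F a)) → WF (⋁ F)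
  wf-⋁ {F} eqv wf = wf , orbitFinite F [] (⋁-invariant {F} eqv) (a₀ ∷ [])
    λ a → here (proj₁ (move a) , (λ _ ()) , rename-at {F} eqv (proj₁ (move a)) (proj₂ (move a)))
    where
    a₀ : Atom k
    a₀ = proj₁ homogeneous
    move : ∀ a → Σ (Aut k) λ π → to π a₀ ≡ a
    move = proj₂ homogeneous

  wf-⋁≠ : ∀ {F} → Equivariant F → (∀ b → WF (F b)) → ∀ a → WF (⋁≠ a F)
  wf-⋁≠ {F} eqv wf a = (λ r → wf (proj₁ r)) ,
    orbitFinite (λ r → F (proj₁ r)) (a ∷ []) (supp-at {λ a → ⋁≠ a F} (⋁≠-equivariant {F} eqv) a)
                (proj₁ (otherAtomOrbits a))
      λ { (b , b≢a) → Any.map (λ { (π , fix , e) → π , fix , rename-at {F} eqv π e })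
                               (proj₂ (otherAtomOrbits a) b b≢a) }

  notFree⇒Pos×Neg : (X : Var k) (φ : Form k) → ¬ Free X φ → Pos X φ × Neg X φ
  notFree⇒Pos×Neg X (atom a)   _  = tt , tt
  notFree⇒Pos×Neg X (var Y)    nf = tt , nf
  notFree⇒Pos×Neg X (disj I f) nf = (λ i → proj₁ (inner i)) , (λ i → proj₂ (inner i))
    where
    inner : ∀ i → Pos X (f i) × Neg X (f i)
    inner i = notFree⇒Pos×Neg X (f i) (λ fr → nf (i , fr))
  notFree⇒Pos×Neg X (neg φ)    nf = proj₂ inner , proj₁ inner
    where
    inner : Pos X φ × Neg X φ
    inner = notFree⇒Pos×Neg X φ nf
  notFree⇒Pos×Neg X (dia φ)    nf = notFree⇒Pos×Neg X φ nf
  notFree⇒Pos×Neg X (mu Y φ)   nf with X ≟V Y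
  ... | yes _   = tt , tt
  ... | no X≢Y = notFree⇒Pos×Neg X φ (λ fr → nf (X≢Y , fr))

  neg-∧ : ∀ {X φ ψ} → Neg X φ → Neg X ψ → Neg X (φ ∧ ψ)
  neg-∧ nφ nψ = λ { true → nφ ; false → nψ }

  free-∧ : ∀ {X φ ψ} → Free X (φ ∧ ψ) → Free X φ ⊎ Free X ψ
  free-∧ (true  , fr) = inj₁ fr
  free-∧ (false , fr) = inj₂ fr

  closed-∧ : ∀ {φ ψ} → Closed φ → Closed ψ → Closed (φ ∧ ψ)
  closed-∧ cφ cψ X fr with free-∧ fr
  ... | inj₁ frφ = cφ X frφ
  ... | inj₂ frψ = cψ X frψ

  closed-disj : ∀ {I} {f : I → Form k} → (∀ i → Closed (f i)) → Closed (disj I f)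
  closed-disj c X (i , fr) = c i X fr

  closed-atom : (a : Atom k) → Closed (atom a)
  closed-atom a X ()

module TheFormula {k : AtomKind} where

  X₀ : Var k
  X₀ = 0 , []

  noAtom : Form k
  noAtom = neg (⋁ atom)

  lost : Atom k → Form k
  lost b = atom b ∧ dia (neg (atom b))

  persistent : Form k
  persistent = neg (⋁ lost)

  gained : Atom k → Form k
  gained b = neg (atom b) ∧ dia (atom b)

  onlyGains : Atom k → Form k
  onlyGains a = neg (⋁≠ a gained)

  escapes : Atom k → Form k
  escapes a = dia (atom a ∧ neg (var X₀))

  addsFresh : Atom k → Form k
  addsFresh a = neg (atom a) ∧ onlyGains a ∧ escapes a

  body : Form k
  body = persistent ∧ ⋁ addsFresh

  -- Φ = noAtom ∧ νX₀. persistent ∧ ⋁ₐ (¬a ∧ onlyGains a ∧ ◇(a ∧ X₀)),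
  -- with the greatest fixpoint written as ¬μX₀.¬body (body mentions ¬X₀).
  Φ : Form k
  Φ = noAtom ∧ neg (mu X₀ (neg body))

  lost-equivariant : Equivariant lost
  lost-equivariant π b = ∧-≃ π (refl , refl) (refl , refl)

  gained-equivariant : Equivariant gained
  gained-equivariant π b = ∧-≃ π (refl , refl) (refl , refl)

  onlyGains-equivariant : Equivariant onlyGains
  onlyGains-equivariant = ⋁≠-equivariant {F = gained} gained-equivariant

  escapes-equivariant : Equivariant escapes
  escapes-equivariant π a = ∧-≃ π (refl , refl) (refl , refl)

  addsFresh-equivariant : Equivariant addsFresh
  addsFresh-equivariant π a =
    ∧-≃ π (refl , refl) (∧-≃ π (onlyGains-equivariant π a) (escapes-equivariant π a))

  body-invariant : Supp [] body
  body-invariant π fix = ∧-≃ π (⋁-invariant {F = lost} lost-equivariant π fix)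
                                (⋁-invariant {F = addsFresh} addsFresh-equivariant π fix)

  wf-∧-at : ∀ {F G : Atom k → Form k} → Equivariant F → Equivariant G →
            ∀ b → WF (F b) → WF (G b) → WF (F b ∧ G b)
  wf-∧-at {F} {G} eqF eqG b = wf-∧ (b ∷ []) (supp-at {F = F} eqF b) (supp-at {F = G} eqG b)

  wf-lost : ∀ b → WF (lost b)
  wf-lost b = wf-∧-at {atom} {λ b → dia (neg (atom b))}
                atom-equivariant (λ π b → refl , refl) b (lift tt) (lift tt)

  wf-gained : ∀ b → WF (gained b)
  wf-gained b = wf-∧-at {λ b → neg (atom b)} {λ b → dia (atom b)}
                  (λ π b → refl , refl) (λ π b → refl , refl) b (lift tt) (lift tt)

  wf-escapes : ∀ a → WF (escapes a)
  wf-escapes a = wf-∧-at {atom} {λ _ → neg (var X₀)}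
                   atom-equivariant (λ π b → refl , refl) a (lift tt) (lift tt)

  wf-addsFresh : ∀ a → WF (addsFresh a)
  wf-addsFresh a = wf-∧-at {λ a → neg (atom a)} {λ a → onlyGains a ∧ escapes a}
    (λ π b → refl , refl) (λ π b → ∧-≃ π (onlyGains-equivariant π b) (escapes-equivariant π b))
    a (lift tt)
    (wf-∧-at {onlyGains} {escapes} onlyGains-equivariant escapes-equivariant a
       (wf-⋁≠ {F = gained} gained-equivariant wf-gained a) (wf-escapes a))

  wf-body : WF body
  wf-body = wf-∧ [] (⋁-invariant {F = lost} lost-equivariant) (⋁-invariant {F = addsFresh} addsFresh-equivariant)
                 (wf-⋁ {F = lost} lost-equivariant wf-lost) (wf-⋁ {F = addsFresh} addsFresh-equivariant wf-addsFresh)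

  closed-lost : ∀ b → Closed (lost b)
  closed-lost b = closed-∧ {φ = atom b} (closed-atom b) (closed-atom b)

  closed-gained : ∀ b → Closed (gained b)
  closed-gained b = closed-∧ {φ = neg (atom b)} (closed-atom b) (closed-atom b)

  closed-persistent : Closed persistent
  closed-persistent = closed-disj {f = lost} closed-lost

  closed-onlyGains : ∀ a → Closed (onlyGains a)
  closed-onlyGains a = closed-disj {f = λ r → gained (proj₁ r)} (λ r → closed-gained (proj₁ r))

  -- X₀ is the only free variable of body, and it occurs there only negatively,
  -- i.e. positively in ¬body, as μX₀ requires.
  free-body : ∀ X → Free X body → X ≡ X₀
  free-body X fr = [ (λ frP → ⊥-elim (closed-persistent X frP)) , free-addsFresh ] (free-∧ {φ = persistent} fr)
    where
    free-escapes : ∀ a → Free X (atom a ∧ neg (var X₀)) → X ≡ X₀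
    free-escapes a fr = [ (λ ()) , (λ X≡X₀ → X≡X₀) ] (free-∧ {φ = atom a} fr)
    free-addsFresh : Free X (⋁ addsFresh) → X ≡ X₀
    free-addsFresh (a , fr) = [ (λ ()) , (λ frR → [ (λ frO → ⊥-elim (closed-onlyGains a X frO)) , free-escapes a ]
                                                      (free-∧ {φ = onlyGains a} frR)) ]
                                (free-∧ {φ = neg (atom a)} fr)

  negative-body : Neg X₀ body
  negative-body = neg-∧ {φ = persistent} (proj₂ (notFree⇒Pos×Neg X₀ persistent (closed-persistent X₀)))
    λ a → neg-∧ {φ = neg (atom a)} tt
            (neg-∧ {φ = onlyGains a} (proj₂ (notFree⇒Pos×Neg X₀ (onlyGains a) (closed-onlyGains a X₀)))
                   (neg-∧ {φ = atom a} tt tt))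

  wf-Φ : WF Φ
  wf-Φ = wf-∧ [] (⋁-invariant {F = atom} atom-equivariant)
              (λ π fix → (refl , proj₁ (body-invariant π fix)) , (refl , proj₂ (body-invariant π fix)))
              (wf-⋁ {F = atom} atom-equivariant (λ _ → lift tt)) (wf-body , lift negative-body)

  closed-Φ : Closed Φ
  closed-Φ = closed-∧ {φ = noAtom} (closed-disj {f = atom} closed-atom) (λ X fr → proj₁ fr (free-body X (proj₂ fr)))

-- Introduction and elimination rules for ∧ in any model.  Since ⟦_⟧ is
-- constructive, elimination is available only towards ⊥.
module Conjunction {k : AtomKind} (M : Model k) where

  ∧-intro : ∀ {φ ψ : Form k} {ρ x} → ⟦_⟧ M φ ρ x → ⟦_⟧ M ψ ρ x → ⟦_⟧ M (φ ∧ ψ) ρ x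
  ∧-intro p q (lift true  , ¬p) = ¬p p
  ∧-intro p q (lift false , ¬q) = ¬q q

  ∧-elim : ∀ {φ ψ : Form k} {ρ x} → ⟦_⟧ M (φ ∧ ψ) ρ x → (⟦_⟧ M φ ρ x → ⟦_⟧ M ψ ρ x → ⊥) → ⊥
  ∧-elim s f = s (lift true , λ p → s (lift false , λ q → f p q))

∈-map⁻-injective : ∀ {A : Set} (f : A → A) → Injective _≡_ _≡_ f →
                   ∀ {x L} → f x ∈ map f L → x ∈ L
∈-map⁻-injective f inj fx∈ with ∈-map⁻ f fx∈
... | y , y∈L , fx≡fy = subst (_∈ _) (sym (inj fx≡fy)) y∈L

-- A state (a , L) records the atoms L
-- collected so far (the predicates it satisfies) and the next atom a; a
-- transition collects a and picks a new next atom outside the collection.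
-- From the empty history, every path keeps adding fresh atoms, as Φ demands.
module HistoryModel {k : AtomKind} where
  open TheFormula {k}

  History : Set
  History = Atom k × List (Atom k)

  _⟶_ : History → History → Set
  (a , L) ⟶ (b , L') = (L' ≡ a ∷ L) × b ∉ L'

  rename : Aut k → History → History
  rename π (a , L) = to π a , map (to π) L

  ⟶-equivariant : ∀ π x y → (x ⟶ y → rename π x ⟶ rename π y) × (rename π x ⟶ rename π y → x ⟶ y)
  ⟶-equivariant π (a , L) (b , L') =
    (λ { (e , b∉L') → cong (map (to π)) e , λ πb∈ → b∉L' (∈-map⁻-injective (to π) (to-injective π) πb∈) }) ,
    (λ { (e , πb∉) → ListP.map-injective (to-injective π) e , λ b∈L' → πb∉ (∈-map⁺ (to π) b∈L') })

  model : Model k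
  model = record
    { S        = []
    ; State    = History
    ; _≈_      = _≡_
    ; ≈-refl   = refl
    ; ≈-sym    = sym
    ; ≈-trans  = trans
    ; act      = λ π _ → rename π
    ; act-cong = λ π _ → cong (rename π)
    ; act-ext  = λ π _ σ _ π≗σ x → cong₂ _,_ (π≗σ (proj₁ x)) (ListP.map-cong π≗σ (proj₂ x))
    ; act-id   = λ x → cong₂ _,_ (to-idA (proj₁ x)) (trans (ListP.map-cong to-idA (proj₂ x)) (ListP.map-id (proj₂ x)))
    ; act-∘    = λ σ _ π _ x → cong (to σ (to π (proj₁ x)) ,_) (ListP.map-∘ (proj₂ x))
    ; fin-supp = λ x → (proj₁ x ∷ proj₂ x) , λ π _ fix →
                   cong₂ _,_ (fix (proj₁ x) (here refl)) (ListP.map-id-local (All.tabulate (λ c∈ → fix _ (there c∈))))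
    ; _⟶_      = _⟶_
    ; ⟶-resp   = λ { refl refl x⟶y → x⟶y }
    ; ⟶-supp   = λ π _ → ⟶-equivariant π
    ; _⊨_      = λ x b → b ∈ proj₂ x
    ; ⊨-resp   = λ { refl x⊨b → x⊨b }
    ; ⊨-supp   = λ π _ x b → ∈-map⁺ (to π) , ∈-map⁻-injective (to π) (to-injective π)
    }

  open Conjunction model

  -- A history is good if its next atom is fresh; the successors of good
  -- histories are good, which is what lets them escape the set of bad ones.
  Good : History → Set
  Good (a , L) = a ∉ L

  ρ-bad : Env model
  ρ-bad = _[_↦_] model (emptyEnv model) X₀ (λ y → Lift _ (¬ Good y))

  persistent-holds : ∀ ρ y → ⟦_⟧ model persistent ρ y
  persistent-holds ρ (a , L) (lift b , lostb) = ∧-elim {φ = atom b} lostb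
    λ { (lift b∈L) (lift z , lift (e , _) , ¬b) → ¬b (lift (subst (b ∈_) (sym e) (there b∈L))) }

  onlyGains-holds : ∀ ρ a L → ⟦_⟧ model (onlyGains a) ρ (a , L)
  onlyGains-holds ρ a L (lift (b , b≢a) , gainedb) = ∧-elim {φ = neg (atom b)} gainedb
    λ { ¬b∈L (lift z , lift (e , _) , lift b∈z) → collected (subst (b ∈_) e b∈z) ¬b∈L }
    where
    collected : b ∈ a ∷ L → ¬ Lift _ (b ∈ L) → ⊥
    collected (here b≡a) _    = b≢a b≡a
    collected (there b∈L) ¬b∈L = ¬b∈L (lift b∈L)

  -- Some successor of (a , L) collects a and, having a fresh next atom, is good.
  escapes-holds : ∀ a L → ⟦_⟧ model (escapes a) ρ-bad (a , L)
  escapes-holds a L = lift (c , a ∷ L) , lift (refl , c∉) ,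
                      ∧-intro {φ = atom a} (lift (here refl)) (λ { (lift bad) → bad c∉ })
    where
    c : Atom k
    c = proj₁ (fresh (a ∷ L))
    c∉ : c ∉ a ∷ L
    c∉ = proj₂ (fresh (a ∷ L))

  body-holds : ∀ y → Good y → ⟦_⟧ model body ρ-bad y
  body-holds (a , L) good = ∧-intro {φ = persistent} (persistent-holds ρ-bad (a , L))
    (lift a , ∧-intro {φ = neg (atom a)} (λ { (lift a∈L) → good a∈L })
                (∧-intro {φ = onlyGains a} (onlyGains-holds ρ-bad a L) (escapes-holds a L)))

  -- The empty history satisfies Φ: it has no predicates, and it is not in
  -- the least fixpoint of ¬body, since the bad histories form a prefixed point.
  start : History
  start = proj₁ homogeneous , []

  Φ-holds : Sat model start Φ
  Φ-holds = ∧-intro {φ = noAtom} (λ { (lift a , lift ()) })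
    λ inμ → inμ (λ y → ¬ Good y) (λ y ¬body good → ¬body (body-holds y good)) (λ ())

-- The double-negation monad (heterogeneous in universe levels, unlike
-- the library's ¬¬-Monad); used with do-notation below.
module DoubleNegation where

  return : ∀ {a} {A : Set a} → A → ¬ ¬ A
  return x ¬x = ¬x x

  _>>=_ : ∀ {a b} {A : Set a} {B : Set b} → ¬ ¬ A → (A → ¬ ¬ B) → ¬ ¬ B
  (m >>= f) ¬b = m (λ x → f x ¬b)

open DoubleNegation

module Impossibility {k : AtomKind} (M : Model k) where
  open Model M
  open TheFormula {k}
  open Conjunction M

  Renaming : State → State → Set
  Renaming y' y = Σ (Atom k → Atom k) λ τ → Injective _≡_ _≡_ τ × (∀ b → y' ⊨ b → y ⊨ τ b)

  InOrbitOf : State → List (Atom k) → State → Set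
  InOrbitOf r T y = Σ (Aut k) λ π → Σ (Fixes π S) λ p → Fixes π T × (y ≈ act π p r)

  sameOrbit⇒renaming : ∀ {r T y y'} → InOrbitOf r T y → InOrbitOf r T y' → Renaming y' y
  sameOrbit⇒renaming {r} {y = y} {y' = y'} (σ , q , _ , y≈σr) (π , p , _ , y'≈πr) = τ , τ-injective , transport
    where
    τ : Atom k → Atom k
    τ b = to σ (from π b)
    τ-injective : Injective _≡_ _≡_ τ
    τ-injective {a} {b} e = trans (sym (to∘from π a)) (trans (cong (to π) (to-injective σ e)) (to∘from π b))
    transport : ∀ b → y' ⊨ b → y ⊨ τ b
    transport b y'⊨b = ⊨-resp (≈-sym y≈σr) (proj₁ (⊨-supp σ q r (from π b))
      (proj₂ (⊨-supp π p r (from π b)) (subst (act π p r ⊨_) (sym (to∘from π b)) (⊨-resp y'≈πr y'⊨b))))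

  orbitCount : OrbitFiniteModel M → ℕ
  orbitCount (_ , reps , _) = length reps

  -- Pigeonhole: among orbitCount + 1 states, two share an orbit.
  repeatedOrbit : (of : OrbitFiniteModel M) (ys : ℕ → State) →
    Σ ℕ λ i → Σ ℕ λ j → i < j × j ≤ orbitCount of × Renaming (ys j) (ys i)
  repeatedOrbit (T , reps , cover) ys = fromCollision (FinP.pigeonhole (ℕP.n<1+n (length reps)) orbitOf)
    where
    orbitOf : Fin (suc (length reps)) → Fin (length reps)
    orbitOf i = Any.index (cover (ys (toℕ i)))
    inOrbit : ∀ i → InOrbitOf (lookup reps (orbitOf i)) T (ys (toℕ i))
    inOrbit i = lookup-index (cover (ys (toℕ i)))
    fromCollision : (Σ (Fin _) λ i → Σ (Fin _) λ j → toℕ i < toℕ j × orbitOf i ≡ orbitOf j) →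
      Σ ℕ λ i → Σ ℕ λ j → i < j × j ≤ length reps × Renaming (ys j) (ys i)
    fromCollision (i , j , i<j , same) = toℕ i , toℕ j , i<j , s≤s⁻¹ (FinP.toℕ<n j) ,
      sameOrbit⇒renaming (inOrbit i)
        (subst (λ w → InOrbitOf (lookup reps w) T (ys (toℕ j))) (sym same) (inOrbit j))

  record Step (y : State) (a : Atom k) (z : State) : Set where
    field
      new-here : ¬ y ⊨ a
      added    : z ⊨ a
      kept     : ∀ b → y ⊨ b → ¬ ¬ z ⊨ b
      only-a   : ∀ b → b ≢ a → ¬ y ⊨ b → ¬ z ⊨ b

  record Chain (N : ℕ) (y : State) : Set where
    field
      state  : ℕ → State
      atomAt : ℕ → Atom k
      starts : state 0 ≡ y
      steps  : ∀ m → m < N → Step (state m) (atomAt m) (state (suc m))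

  _◅_ : ∀ {N y a z} → Step y a z → Chain N z → Chain (suc N) y
  _◅_ {N} {y} {a} st ch = record { state = state′ ; atomAt = atomAt′ ; starts = refl ; steps = steps′ }
    where
    open Chain ch
    state′ : ℕ → State
    state′ zero    = y
    state′ (suc m) = state m
    atomAt′ : ℕ → Atom k
    atomAt′ zero    = a
    atomAt′ (suc m) = atomAt m
    steps′ : ∀ m → m < suc N → Step (state′ m) (atomAt′ m) (state′ (suc m))
    steps′ zero    _   = subst (Step y a) (sym starts) st
    steps′ (suc m) m<N = steps m (s≤s⁻¹ m<N)

  chains : ∀ {ℓ} (Q : State → Set ℓ) →
    (∀ {y} → Q y → ¬ ¬ (Σ (Atom k) λ a → Σ State λ z → Step y a z × Q z)) →
    ∀ N {y} → Q y → ¬ ¬ Chain N y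
  -- (the atoms of the empty chain are never consulted)
  chains Q extend zero {y} _ = return (record
    { state = λ _ → y ; atomAt = λ _ → proj₁ homogeneous ; starts = refl ; steps = λ _ () })
  chains Q extend (suc N) qy = do
    (a , z , st , qz) ← extend qy
    ch ← chains Q extend N qz
    return (st ◅ ch)

  -- Along a chain from a state without predicates, the predicates of y_n
  -- are exactly the atoms added before n; these are pairwise distinct, so
  -- y_j has more predicates than y_i for i < j and cannot be renamed into it.
  module ChainFacts {N x} (ch : Chain N x) (empty : ∀ b → ¬ x ⊨ b) where
    open Chain ch
    open Step

    holds : ∀ {m n} → m < n → n ≤ N → ¬ ¬ state n ⊨ atomAt m
    holds {m} {suc n} m<1+n n<N with ℕP.m<1+n⇒m<n∨m≡n m<1+n
    ... | inj₂ refl = return (added (steps n n<N))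
    ... | inj₁ m<n  = holds m<n (ℕP.<⇒≤ n<N) >>= kept (steps n n<N) (atomAt m)

    onlyAdded : ∀ n → n ≤ N → ∀ b → (∀ m → m < n → b ≢ atomAt m) → ¬ state n ⊨ b
    onlyAdded zero    _   b _     = subst (λ y → ¬ y ⊨ b) (sym starts) (empty b)
    onlyAdded (suc n) n<N b fresh = only-a (steps n n<N) b (fresh n (ℕP.n<1+n n))
      (onlyAdded n (ℕP.<⇒≤ n<N) b (λ m m<n → fresh m (ℕP.m<n⇒m<1+n m<n)))

    distinct : ∀ {m m'} → m < m' → m' < N → atomAt m ≢ atomAt m'
    distinct m<m' m'<N e = holds m<m' (ℕP.<⇒≤ m'<N) λ p →
      new-here (steps _ m'<N) (subst (state _ ⊨_) e p)

    noRenaming : ∀ {i j} → i < j → j ≤ N → ¬ Renaming (state j) (state i)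
    noRenaming {i} {j} i<j j≤N (τ , τ-injective , transport) =
      noCollision (FinP.pigeonhole i<j (λ m → proj₁ (image m)))
      where
      -- τ sends each atom added before j to one added before i.
      image : (m : Fin j) → Σ (Fin i) λ w → τ (atomAt (toℕ m)) ≡ atomAt (toℕ w)
      image m with FinP.any? (λ w → τ (atomAt (toℕ m)) ≟A atomAt (toℕ w))
      ... | yes found = found
      ... | no none   = ⊥-elim (holds (FinP.toℕ<n m) j≤N λ p →
              onlyAdded i (ℕP.<⇒≤ (ℕP.<-≤-trans i<j j≤N)) _
                (λ m' m'<i e → none (fromℕ< m'<i , trans e (cong atomAt (sym (FinP.toℕ-fromℕ< m'<i)))))
                (transport _ p))
      -- but distinct atoms cannot share an image under the injective τ.
      noCollision : ¬ (Σ (Fin j) λ u → Σ (Fin j) λ v → toℕ u < toℕ v × proj₁ (image u) ≡ proj₁ (image v))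
      noCollision (u , v , u<v , same) = distinct u<v (ℕP.<-≤-trans (FinP.toℕ<n v) j≤N)
        (τ-injective (trans (proj₂ (image u)) (trans (cong (λ w → atomAt (toℕ w)) same) (sym (proj₂ (image v))))))

  noUnboundedChains : OrbitFiniteModel M → ∀ {x} → (∀ b → ¬ x ⊨ b) → ¬ (∀ N → ¬ ¬ Chain N x)
  noUnboundedChains of {x} empty chainsFrom = chainsFrom (orbitCount of) noLongChain
    where
    noLongChain : ¬ Chain (orbitCount of) x
    noLongChain ch with i , j , i<j , j≤N , rename-j-i ← repeatedOrbit of (Chain.state ch)
      = ChainFacts.noRenaming ch empty i<j j≤N rename-j-i

  body-step : ∀ {ρ y} → ⟦_⟧ M body ρ y → ¬ ¬ (Σ (Atom k) λ a → Σ State λ z → Step y a z × ¬ ρ X₀ z)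
  body-step b k′ = ∧-elim {φ = persistent} b λ P (lift a , adds) →
    ∧-elim {φ = neg (atom a)} adds λ ¬y⊨a rest →
    ∧-elim {φ = onlyGains a} rest λ O (lift z , lift y⟶z , esc) →
    ∧-elim {φ = atom a} esc λ (lift z⊨a) z∉ρ →
    k′ (a , z , record
      { new-here = λ y⊨a → ¬y⊨a (lift y⊨a)
      ; added    = z⊨a
      ; kept     = λ b y⊨b ¬z⊨b → P (lift b ,
                     ∧-intro {φ = atom b} (lift y⊨b) (lift z , lift y⟶z , λ { (lift z⊨b) → ¬z⊨b z⊨b }))
      ; only-a   = λ b b≢a ¬y⊨b z⊨b → O (lift (b , b≢a) ,
                     ∧-intro {φ = neg (atom b)} (λ { (lift y⊨b) → ¬y⊨b y⊨b }) (lift z , lift y⟶z , lift z⊨b))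
      } , z∉ρ)

  -- A state x satisfying Φ has no predicates and lies outside μX₀.¬body.
  -- But x lies in every prefixed point A of ¬body: otherwise body holds at x,
  -- and by body-step every body-state outside A steps to another one, giving
  -- chains of every length from x.
  Φ-unsatisfiable : OrbitFiniteModel M → ∀ x → ¬ Sat M x Φ
  Φ-unsatisfiable of x sat = ∧-elim {φ = noAtom} sat λ noAtom-x notInμ → notInμ (inμ noAtom-x)
    where
    inμ : ⟦_⟧ M noAtom (emptyEnv M) x → ⟦_⟧ M (mu X₀ (neg body)) (emptyEnv M) x
    inμ noAtom-x A prefixed = prefixed x λ body-x →
      noUnboundedChains of (λ b x⊨b → noAtom-x (lift b , lift x⊨b)) (λ N → chains (⟦_⟧ M body ρA) extend N body-x)
      where
      ρA : Env M
      ρA = _[_↦_] M (emptyEnv M) X₀ (λ z → Lift _ (A z))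
      extend : ∀ {y} → ⟦_⟧ M body ρA y → ¬ ¬ (Σ (Atom k) λ a → Σ State λ z → Step y a z × ⟦_⟧ M body ρA z)
      extend body-y = do
        (a , z , st , z∉A) ← body-step body-y
        body-z ← (λ ¬body-z → z∉A (lift (prefixed z ¬body-z)))
        return (a , z , st , body-z)

mainTheorem10 : (k : AtomKind) →
    Σ (Form k) λ φ →
    WF φ × Closed φ
    × (Σ (Model k) λ M → Σ (Model.State M) λ x → Sat M x φ)
    × ¬ (Σ (Model k) λ M → OrbitFiniteModel M × Σ (Model.State M) λ x → Sat M x φ)
mainTheorem10 k = Φ , wf-Φ , closed-Φ
  , (HistoryModel.model , HistoryModel.start , HistoryModel.Φ-holds)
  , λ { (M , orbitFinite-M , x , sat) → Impossibility.Φ-unsatisfiable M orbitFinite-M x sat }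
  where open TheFormula {k}
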